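{- For every positive integer $t$ there is a constant $C=C(t)$ such that the following holds. If $G$ is a graph on $n$ vertices with maximum degree at most $\Delta$ that contains no subgraph isomorphic to $K_{t,t,t}$, then $G$ contains at most $Cn\Delta^{2-1/t^2}$ triangles.
   Context: $K_{t,t,t}$ is the complete tripartite graph with three parts of size $t$; subgraphs need not be induced. A triangle is a copy of $K_3$ in $G$. -}

module Defs where

open import Data.Nat using (ℕ; _+_; _<ᵇ_)
open import Data.Bool using (Bool; true; false; _∧_; if_then_else_)
open import Data.Fin using (Fin; toℕ)
open import Data.List using (List; map; concatMap; allFin)
open import Data.Nat.ListAction using (sum)
open import Data.Product using (Σ; _×_)
open import Relation.Binary.PropositionalEquality using (_≡_; _≢_)

record Graph (n : ℕ) : Set where
  field
    adj    : Fin n → Fin n → Bool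
    sym    : ∀ u v → adj u v ≡ adj v u
    irrefl : ∀ v → adj v v ≡ false
open Graph public

b2n : Bool → ℕ
b2n true  = 1
b2n false = 0

degree : ∀ {n} → Graph n → Fin n → ℕ
degree {n} G v = sum (map (λ w → b2n (adj G v w)) (allFin n))

triangles : ∀ {n} → Graph n → ℕ
triangles {n} G =
  sum (concatMap (λ i → concatMap (λ j → map (λ k →
    b2n ((toℕ i <ᵇ toℕ j) ∧ (toℕ j <ᵇ toℕ k)
         ∧ adj G i j ∧ adj G j k ∧ adj G i k))
    (allFin n)) (allFin n)) (allFin n))

-- G contains a (not necessarily induced) subgraph isomorphic to K_{t,t,t}:
-- an injective placement f of the 3t vertices (part a, index x) such that
-- any two vertices in different parts are adjacent in G.
ContainsKttt : ∀ {n} → Graph n → ℕ → Set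
ContainsKttt {n} G t =
  Σ (Fin 3 → Fin t → Fin n) λ f →
    (∀ a b x y → f a x ≡ f b y → (a ≡ b) × (x ≡ y)) ×
    (∀ a b x y → a ≢ b → adj G (f a x) (f b y) ≡ true)

-- Let T = Σ_{xy ∈ E} codeg(x, y), six times the number of triangles. The power-mean inequality
-- (Σ u w)ᵗ ≤ (Σ u)ᵗ⁻¹ Σ u wᵗ over the edges gives Tᵗ ≤ (nΔ)ᵗ⁻¹ Σ_{xy ∈ E} codeg(x, y)ᵗ. Expanding
-- codeg(x, y)ᵗ as a count of t-tuples a of common neighbours turns the last sum into
-- Σ_{(a, x) : x ~ a} d(x, a), where d(x, a) counts the neighbours of x adjacent to all of a, and
-- a second power-mean step over the at most nΔᵗ pairs (a, x) bounds its t-th power by (nΔᵗ)ᵗ⁻¹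
-- times the number of triples (a, b, x) of t-tuples a, b spanning a complete bipartite graph and
-- a vertex x adjacent to all their entries. When a and b are injective there are fewer than t
-- such x, as otherwise a, b and t of them form a K_{t,t,t}. There are at most nΔ^{2t−1} pairs
-- (a, b), of which O(nΔ^{2t−2}) repeat an entry and contribute at most Δ each; hence
-- T^{t²} = O(n^{t²} Δ^{2t²−1}).

module Submission where

open import Data.Bool using (true; false; _∧_)
open import Data.Empty using (⊥-elim)
open import Data.Fin using (Fin; zero; suc; toℕ; _≟_; lift)
open import Data.Fin.Properties using (suc-injective; lift-injective)
open import Data.List
  using (List; []; _∷_; map; _++_; concatMap; cartesianProductWith; cartesianProduct; allFin; length)
open import Data.List.Properties using (map-++; map-∘; map-cong; map-tabulate; length-tabulate)
open import Data.Nat using (ℕ; zero; suc; _+_; _*_; _^_; _∸_; _≤_; z≤n; s≤s⁻¹; _<ᵇ_)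
open import Data.Nat.ListAction using (sum)
open import Data.Nat.ListAction.Properties using (sum-++)
open import Data.Nat.Properties hiding (suc-injective; _≟_)
open import Algebra.Properties.CommutativeSemigroup +-commutativeSemigroup
  using () renaming (interchange to +-interchange)
open import Algebra.Properties.CommutativeSemigroup *-commutativeSemigroup
  using (x∙yz≈y∙xz; x∙yz≈z∙xy) renaming (interchange to *-interchange)
open import Data.Nat.Tactic.RingSolver using (solve-∀)
open import Data.Product using (∃-syntax; Σ-syntax; _×_; _,_)
open import Data.Sum using ([_,_]′; inj₁; inj₂)
open import Data.Vec using (Vec; []; _∷_; lookup)
open import Function using (_∘_; _$_; id)
open import Function.Definitions using (Injective)
open import Relation.Binary.PropositionalEquality
open import Relation.Nullary using (¬_; does; yes; no)
open import Relation.Nullary.Decidable using (dec-true)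

open import Defs hiding (sym)

private
  variable
    X Y Z : Set
    p q : ℕ

m*n≤m : ∀ m {n} → n ≤ 1 → m * n ≤ m
m*n≤m m n≤1 = ≤-trans (*-monoʳ-≤ m n≤1) (≤-reflexive (*-identityʳ m))

m*n≤n : ∀ {m} n → m ≤ 1 → m * n ≤ n
m*n≤n {m} n m≤1 = subst (_≤ n) (*-comm n m) (m*n≤m n m≤1)

^-distribʳ-* : ∀ m n k → (m * n) ^ k ≡ m ^ k * n ^ k
^-distribʳ-* m n zero    = refl
^-distribʳ-* m n (suc k) = trans (cong (m * n *_) (^-distribʳ-* m n k)) (*-interchange m n (m ^ k) (n ^ k))

-- Finite sums and products

infix 5 ∑
∑ : List X → (X → ℕ) → ℕ
∑ xs f = sum (map f xs)

syntax ∑ xs (λ x → e) = ∑[ x ∈ xs ] e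

∑-cong : ∀ (xs : List X) {f g : X → ℕ} → (∀ x → f x ≡ g x) → ∑ xs f ≡ ∑ xs g
∑-cong xs f≗g = cong sum (map-cong f≗g xs)

∑-mono-≤ : ∀ (xs : List X) {f g : X → ℕ} → (∀ x → f x ≤ g x) → ∑ xs f ≤ ∑ xs g
∑-mono-≤ []       f≤g = z≤n
∑-mono-≤ (x ∷ xs) f≤g = +-mono-≤ (f≤g x) (∑-mono-≤ xs f≤g)

∑-distrib-+ : ∀ (xs : List X) (f g : X → ℕ) → ∑[ x ∈ xs ] f x + g x ≡ ∑ xs f + ∑ xs g
∑-distrib-+ []       f g = refl
∑-distrib-+ (x ∷ xs) f g =
  trans (cong (f x + g x +_) (∑-distrib-+ xs f g)) (+-interchange (f x) (g x) _ _)

*-distribˡ-∑ : ∀ (xs : List X) c (f : X → ℕ) → c * ∑ xs f ≡ ∑[ x ∈ xs ] c * f x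
*-distribˡ-∑ []       c f = *-zeroʳ c
*-distribˡ-∑ (x ∷ xs) c f =
  trans (*-distribˡ-+ c (f x) (∑ xs f)) (cong (c * f x +_) (*-distribˡ-∑ xs c f))

*-distribʳ-∑ : ∀ (xs : List X) c (f : X → ℕ) → ∑ xs f * c ≡ ∑[ x ∈ xs ] f x * c
*-distribʳ-∑ xs c f = begin
  ∑ xs f * c          ≡⟨ *-comm (∑ xs f) c ⟩
  c * ∑ xs f          ≡⟨ *-distribˡ-∑ xs c f ⟩
  ∑[ x ∈ xs ] c * f x ≡⟨ ∑-cong xs (λ x → *-comm c (f x)) ⟩
  ∑[ x ∈ xs ] f x * c ∎
  where open ≡-Reasoning

∑-const : ∀ (xs : List X) c → ∑[ _ ∈ xs ] c ≡ length xs * c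
∑-const []       c = refl
∑-const (x ∷ xs) c = cong (c +_) (∑-const xs c)

∑-zero : ∀ (xs : List X) → ∑[ _ ∈ xs ] 0 ≡ 0
∑-zero xs = trans (∑-const xs 0) (*-zeroʳ (length xs))

∑-comm : ∀ (xs : List X) (ys : List Y) (f : X → Y → ℕ) →
         ∑[ x ∈ xs ] ∑[ y ∈ ys ] f x y ≡ ∑[ y ∈ ys ] ∑[ x ∈ xs ] f x y
∑-comm []       ys f = sym (∑-zero ys)
∑-comm (x ∷ xs) ys f = trans (cong (∑ ys (f x) +_) (∑-comm xs ys f))
                             (sym (∑-distrib-+ ys (f x) (λ y → ∑[ x ∈ xs ] f x y)))

∑∑-distrib-+ : ∀ (xs : List X) (ys : List Y) (f g : X → Y → ℕ) →
  ∑[ x ∈ xs ] ∑[ y ∈ ys ] f x y + g x y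
    ≡ (∑[ x ∈ xs ] ∑[ y ∈ ys ] f x y) + (∑[ x ∈ xs ] ∑[ y ∈ ys ] g x y)
∑∑-distrib-+ xs ys f g = trans (∑-cong xs (λ x → ∑-distrib-+ ys (f x) (g x))) (∑-distrib-+ xs _ _)

*-distribˡ-∑∑ : ∀ (xs : List X) (ys : List Y) c (f : X → Y → ℕ) →
  c * (∑[ x ∈ xs ] ∑[ y ∈ ys ] f x y) ≡ ∑[ x ∈ xs ] ∑[ y ∈ ys ] c * f x y
*-distribˡ-∑∑ xs ys c f = trans (*-distribˡ-∑ xs c _) (∑-cong xs (λ x → *-distribˡ-∑ ys c (f x)))

∑-*-∑ : ∀ (xs : List X) (ys : List Y) (f : X → ℕ) (g : Y → ℕ) →
        ∑ xs f * ∑ ys g ≡ ∑[ x ∈ xs ] ∑[ y ∈ ys ] f x * g y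
∑-*-∑ xs ys f g = trans (*-distribʳ-∑ xs (∑ ys g) f)
                        (∑-cong xs (λ x → *-distribˡ-∑ ys (f x) g))

∑-++ : ∀ (xs ys : List X) (f : X → ℕ) → ∑ (xs ++ ys) f ≡ ∑ xs f + ∑ ys f
∑-++ xs ys f = trans (cong sum (map-++ f xs ys)) (sum-++ (map f xs) (map f ys))

∑-map : ∀ (xs : List X) (h : X → Y) (f : Y → ℕ) → ∑ (map h xs) f ≡ ∑ xs (f ∘ h)
∑-map xs h f = cong sum (sym (map-∘ xs))

∑-concatMap : ∀ (xs : List X) (g : X → List ℕ) → sum (concatMap g xs) ≡ ∑[ x ∈ xs ] sum (g x)
∑-concatMap []       g = refl
∑-concatMap (x ∷ xs) g =
  trans (sum-++ (g x) (concatMap g xs)) (cong (sum (g x) +_) (∑-concatMap xs g))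

∑-cartesianProductWith : ∀ (h : X → Y → Z) (xs : List X) (ys : List Y) (f : Z → ℕ) →
  ∑ (cartesianProductWith h xs ys) f ≡ ∑[ x ∈ xs ] ∑[ y ∈ ys ] f (h x y)
∑-cartesianProductWith h []       ys f = refl
∑-cartesianProductWith h (x ∷ xs) ys f =
  trans (∑-++ (map (h x) ys) _ f)
        (cong₂ _+_ (∑-map ys (h x) f) (∑-cartesianProductWith h xs ys f))

∑-allFin-suc : ∀ n (f : Fin (suc n) → ℕ) → ∑ (allFin (suc n)) f ≡ f zero + ∑ (allFin n) (f ∘ suc)
∑-allFin-suc n f = cong (λ fs → f zero + sum fs)
  (trans (map-tabulate suc f) (sym (map-tabulate id (f ∘ suc))))

∑-allFin-const : ∀ n c → ∑[ _ ∈ allFin n ] c ≡ n * c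
∑-allFin-const n c = trans (∑-const (allFin n) c) (cong (_* c) (length-tabulate {n = n} id))

∏ : (X → ℕ) → Vec X p → ℕ
∏ f []      = 1
∏ f (x ∷ a) = f x * ∏ f a

∏-cong : ∀ {f g : X → ℕ} → (∀ x → f x ≡ g x) → (a : Vec X p) → ∏ f a ≡ ∏ g a
∏-cong f≗g []      = refl
∏-cong f≗g (x ∷ a) = cong₂ _*_ (f≗g x) (∏-cong f≗g a)

∏-distrib-* : ∀ (f g : X → ℕ) (a : Vec X p) → ∏ (λ x → f x * g x) a ≡ ∏ f a * ∏ g a
∏-distrib-* f g []      = refl
∏-distrib-* f g (x ∷ a) = trans (cong (f x * g x *_) (∏-distrib-* f g a)) (*-interchange (f x) (g x) _ _)

∏-one : ∀ (a : Vec X p) → ∏ (λ _ → 1) a ≡ 1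
∏-one []      = refl
∏-one (x ∷ a) = trans (+-identityʳ _) (∏-one a)

∏-≤1 : ∀ {f : X → ℕ} → (∀ x → f x ≤ 1) → (a : Vec X p) → ∏ f a ≤ 1
∏-≤1 f≤1 []      = ≤-refl
∏-≤1 f≤1 (x ∷ a) = *-mono-≤ (f≤1 x) (∏-≤1 f≤1 a)

∏≡1⇒≡1 : ∀ (f : X → ℕ) (a : Vec X p) → ∏ f a ≡ 1 → ∀ i → f (lookup a i) ≡ 1
∏≡1⇒≡1 f (x ∷ a) ∏≡1 zero    = m*n≡1⇒m≡1 (f x) _ ∏≡1
∏≡1⇒≡1 f (x ∷ a) ∏≡1 (suc i) = ∏≡1⇒≡1 f a (m*n≡1⇒n≡1 (f x) _ ∏≡1) i

vecs : List X → ∀ p → List (Vec X p)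
vecs xs zero    = [] ∷ []
vecs xs (suc p) = cartesianProductWith _∷_ xs (vecs xs p)

∑-vecs-suc : ∀ (xs : List X) p (f : Vec X (suc p) → ℕ) →
             ∑ (vecs xs (suc p)) f ≡ ∑[ x ∈ xs ] ∑[ a ∈ vecs xs p ] f (x ∷ a)
∑-vecs-suc xs p = ∑-cartesianProductWith _∷_ xs (vecs xs p)

∑-^ : ∀ (xs : List X) (f : X → ℕ) p → ∑ xs f ^ p ≡ ∑[ a ∈ vecs xs p ] ∏ f a
∑-^ xs f zero    = refl
∑-^ xs f (suc p) = begin
  ∑ xs f * ∑ xs f ^ p                           ≡⟨ cong (∑ xs f *_) (∑-^ xs f p) ⟩
  ∑ xs f * ∑ (vecs xs p) (∏ f)                  ≡⟨ ∑-*-∑ xs (vecs xs p) f (∏ f) ⟩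
  ∑[ x ∈ xs ] ∑[ a ∈ vecs xs p ] f x * ∏ f a    ≡⟨ ∑-vecs-suc xs p (∏ f) ⟨
  ∑ (vecs xs (suc p)) (∏ f)                     ∎
  where open ≡-Reasoning

-- The power-mean inequality

-- (wᵗ − vᵗ)(w − v) ≥ 0, rearranged so that no subtraction occurs.
^-rearrangement : ∀ t v w → v ^ t * w + w ^ t * v ≤ v ^ suc t + w ^ suc t
^-rearrangement t v w =
  [ ordered
  , (λ w≤v → subst₂ _≤_ (+-comm (w ^ t * v) (v ^ t * w)) (+-comm (w ^ suc t) (v ^ suc t)) (ordered w≤v))
  ]′ (≤-total v w)
  where
  ordered : ∀ {v w} → v ≤ w → v ^ t * w + w ^ t * v ≤ v ^ suc t + w ^ suc t
  ordered {v} v≤w with m≤n⇒∃[o]m+o≡n v≤w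
  ... | k , refl = begin
    v ^ t * (v + k) + (v + k) ^ t * v             ≡⟨ expand (v ^ t) ((v + k) ^ t) v k ⟩
    v * v ^ t + (v + k) ^ t * v + k * v ^ t       ≤⟨ +-monoʳ-≤ _ (*-monoʳ-≤ k (^-monoˡ-≤ t (m≤m+n v k))) ⟩
    v * v ^ t + (v + k) ^ t * v + k * (v + k) ^ t ≡⟨ collect (v ^ t) ((v + k) ^ t) v k ⟩
    v * v ^ t + (v + k) * (v + k) ^ t             ∎
    where
    open ≤-Reasoning
    expand : ∀ a b v k → a * (v + k) + b * v ≡ v * a + b * v + k * a
    expand = solve-∀
    collect : ∀ a b v k → v * a + b * v + k * b ≡ v * a + (v + k) * b
    collect = solve-∀

module _ (u w : X → ℕ) where

  -- Chebyshev's sum inequality: summing ^-rearrangement over all pairs (x, y) gives twice it.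
  chebyshev : ∀ t (xs : List X) →
    (∑[ x ∈ xs ] u x * w x ^ t) * (∑[ x ∈ xs ] u x * w x) ≤ ∑ xs u * (∑[ x ∈ xs ] u x * w x ^ suc t)
  chebyshev t xs = *-cancelˡ-≤ 2 $ begin
    2 * (A * B)                                    ≡⟨ twice A B ⟩
    A * B + B * A                                  ≡⟨ cong₂ _+_ (∑-*-∑ xs xs _ _) (∑-*-∑ xs xs _ _) ⟩
    (∑[ x ∈ xs ] ∑[ y ∈ xs ] (u x * w x ^ t) * (u y * w y))
      + (∑[ x ∈ xs ] ∑[ y ∈ xs ] (u x * w x) * (u y * w y ^ t)) ≡⟨ ∑∑-distrib-+ xs xs _ _ ⟨
    ∑[ x ∈ xs ] ∑[ y ∈ xs ] (u x * w x ^ t) * (u y * w y) + (u x * w x) * (u y * w y ^ t)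
                                                   ≤⟨ ∑-mono-≤ xs (λ x → ∑-mono-≤ xs (pointwise x)) ⟩
    ∑[ x ∈ xs ] ∑[ y ∈ xs ] (u x * w x ^ suc t) * u y + u x * (u y * w y ^ suc t)
                                                   ≡⟨ ∑∑-distrib-+ xs xs _ _ ⟩
    (∑[ x ∈ xs ] ∑[ y ∈ xs ] (u x * w x ^ suc t) * u y)
      + (∑[ x ∈ xs ] ∑[ y ∈ xs ] u x * (u y * w y ^ suc t))
                                                   ≡⟨ cong₂ _+_ (∑-*-∑ xs xs _ _) (∑-*-∑ xs xs _ _) ⟨
    C * U + U * C                                  ≡⟨ twice C U ⟨
    2 * (C * U)                                    ≡⟨ cong (2 *_) (*-comm C U) ⟩
    2 * (U * C)                                    ∎
    where
    open ≤-Reasoning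
    A = ∑[ x ∈ xs ] u x * w x ^ t
    B = ∑[ x ∈ xs ] u x * w x
    C = ∑[ x ∈ xs ] u x * w x ^ suc t
    U = ∑ xs u
    twice : ∀ a b → 2 * (a * b) ≡ a * b + b * a
    twice = solve-∀
    pointwise : ∀ x y → (u x * w x ^ t) * (u y * w y) + (u x * w x) * (u y * w y ^ t)
                      ≤ (u x * w x ^ suc t) * u y + u x * (u y * w y ^ suc t)
    pointwise x y = begin
      (u x * w x ^ t) * (u y * w y) + (u x * w x) * (u y * w y ^ t)
        ≡⟨ factor (u x) (u y) (w x) (w y) (w x ^ t) (w y ^ t) ⟩
      u x * u y * (w x ^ t * w y + w y ^ t * w x)
        ≤⟨ *-monoʳ-≤ (u x * u y) (^-rearrangement t (w x) (w y)) ⟩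
      u x * u y * (w x ^ suc t + w y ^ suc t)
        ≡⟨ expand (u x) (u y) (w x ^ suc t) (w y ^ suc t) ⟩
      (u x * w x ^ suc t) * u y + u x * (u y * w y ^ suc t) ∎
      where
      factor : ∀ a b c d e f → (a * e) * (b * d) + (a * c) * (b * f) ≡ a * b * (e * d + f * c)
      factor = solve-∀
      expand : ∀ a b c d → a * b * (c + d) ≡ (a * c) * b + a * (b * d)
      expand = solve-∀

  power-mean : ∀ s (xs : List X) →
    (∑[ x ∈ xs ] u x * w x) ^ suc s ≤ ∑ xs u ^ s * (∑[ x ∈ xs ] u x * w x ^ suc s)
  power-mean zero xs = ≤-reflexive $ begin
    (∑[ x ∈ xs ] u x * w x) * 1      ≡⟨ *-identityʳ _ ⟩
    ∑[ x ∈ xs ] u x * w x            ≡⟨ ∑-cong xs (λ x → cong (u x *_) (*-identityʳ (w x))) ⟨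
    ∑[ x ∈ xs ] u x * w x ^ 1        ≡⟨ +-identityʳ _ ⟨
    1 * (∑[ x ∈ xs ] u x * w x ^ 1)  ∎
    where open ≡-Reasoning
  power-mean (suc s) xs = begin
    B * B ^ suc s                    ≤⟨ *-monoʳ-≤ B (power-mean s xs) ⟩
    B * (U ^ s * C)                  ≡⟨ rearrange B (U ^ s) C ⟩
    U ^ s * (C * B)                  ≤⟨ *-monoʳ-≤ (U ^ s) (chebyshev (suc s) xs) ⟩
    U ^ s * (U * D)                  ≡⟨ *-assoc (U ^ s) U D ⟨
    U ^ s * U * D                    ≡⟨ cong (_* D) (*-comm (U ^ s) U) ⟩
    U * U ^ s * D                    ∎
    where
    open ≤-Reasoning
    U = ∑ xs u
    B = ∑[ x ∈ xs ] u x * w x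
    C = ∑[ x ∈ xs ] u x * w x ^ suc s
    D = ∑[ x ∈ xs ] u x * w x ^ suc (suc s)
    rearrange : ∀ b v c → b * (v * c) ≡ v * (c * b)
    rearrange = solve-∀

power-mean₂ : ∀ s (xs : List X) (ys : List Y) (u w : X → Y → ℕ) →
  (∑[ x ∈ xs ] ∑[ y ∈ ys ] u x y * w x y) ^ suc s
    ≤ (∑[ x ∈ xs ] ∑[ y ∈ ys ] u x y) ^ s * (∑[ x ∈ xs ] ∑[ y ∈ ys ] u x y * w x y ^ suc s)
power-mean₂ s xs ys u w = begin
  (∑[ x ∈ xs ] ∑[ y ∈ ys ] u x y * w x y) ^ suc s
    ≡⟨ cong (_^ suc s) (∑-pairs (λ x y → u x y * w x y)) ⟨
  (∑[ (x , y) ∈ pairs ] u x y * w x y) ^ suc s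
    ≤⟨ power-mean (λ (x , y) → u x y) (λ (x , y) → w x y) s pairs ⟩
  (∑[ (x , y) ∈ pairs ] u x y) ^ s * (∑[ (x , y) ∈ pairs ] u x y * w x y ^ suc s)
    ≡⟨ cong₂ (λ l r → l ^ s * r) (∑-pairs u) (∑-pairs (λ x y → u x y * w x y ^ suc s)) ⟩
  (∑[ x ∈ xs ] ∑[ y ∈ ys ] u x y) ^ s * (∑[ x ∈ xs ] ∑[ y ∈ ys ] u x y * w x y ^ suc s) ∎
  where
  open ≤-Reasoning
  pairs = cartesianProduct xs ys
  ∑-pairs : ∀ f → ∑[ (x , y) ∈ pairs ] f x y ≡ ∑[ x ∈ xs ] ∑[ y ∈ ys ] f x y
  ∑-pairs f = ∑-cartesianProductWith _,_ xs ys (λ (x , y) → f x y)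

-- Injective tuples

embed-ones : ∀ {n} (g : Fin n → ℕ) → (∀ x → g x ≤ 1) → ∀ k → k ≤ ∑ (allFin n) g →
  Σ[ c ∈ (Fin k → Fin n) ] Injective _≡_ _≡_ c × (∀ i → g (c i) ≡ 1)
embed-ones g g≤1 zero _ = (λ ()) , (λ { {()} }) , (λ ())
embed-ones {suc n} g g≤1 (suc k) k<∑
  with n≤1⇒n≡0∨n≡1 (g≤1 zero) | subst (suc k ≤_) (∑-allFin-suc n g) k<∑
... | inj₁ g0≡0 | k<g0+∑ rewrite g0≡0 =
  let c , c-inj , c-ones = embed-ones (g ∘ suc) (g≤1 ∘ suc) (suc k) k<g0+∑
  in suc ∘ c , c-inj ∘ suc-injective , c-ones
... | inj₂ g0≡1 | k<g0+∑ rewrite g0≡1 =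
  let c , c-inj , c-ones = embed-ones (g ∘ suc) (g≤1 ∘ suc) k (s≤s⁻¹ k<g0+∑)
  in lift 1 c , lift-injective c c-inj 1 , λ { zero → g0≡1 ; (suc i) → c-ones i }

module _ {n : ℕ} where

  occurrences : Fin n → Vec (Fin n) p → ℕ
  occurrences v []      = 0
  occurrences v (y ∷ a) = b2n (does (v ≟ y)) + occurrences v a

  collisions : Vec (Fin n) p → ℕ
  collisions []      = 0
  collisions (v ∷ a) = occurrences v a + collisions a

∑-≟ : ∀ {n} (y : Fin n) → ∑[ v ∈ allFin n ] b2n (does (v ≟ y)) ≡ 1
∑-≟ {suc n} y = trans (∑-allFin-suc n (λ v → b2n (does (v ≟ y)))) (rest y)
  where
  rest : ∀ y → b2n (does (zero ≟ y)) + (∑[ v ∈ allFin n ] b2n (does (suc v ≟ y))) ≡ 1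
  rest zero    = cong suc (∑-zero (allFin n))
  rest (suc y) = ∑-≟ y

∑-occurrences : ∀ {n} (a : Vec (Fin n) p) → ∑[ v ∈ allFin n ] occurrences v a ≡ p
∑-occurrences {n = n} []      = ∑-zero (allFin n)
∑-occurrences {n = n} (y ∷ a) =
  trans (∑-distrib-+ (allFin n) _ (λ v → occurrences v a)) (cong₂ _+_ (∑-≟ y) (∑-occurrences a))

occurrences≡0⇒∉ : ∀ {n} v (a : Vec (Fin n) p) → occurrences v a ≡ 0 → ∀ j → lookup a j ≢ v
occurrences≡0⇒∉ v (y ∷ a) occ≡0 zero    refl =
  1+n≢0 (trans (sym (cong b2n (dec-true (v ≟ v) refl))) (m+n≡0⇒m≡0 _ occ≡0))
occurrences≡0⇒∉ v (y ∷ a) occ≡0 (suc j) = occurrences≡0⇒∉ v a (m+n≡0⇒n≡0 _ occ≡0) j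

collisions≡0⇒injective : ∀ {n} (a : Vec (Fin n) p) → collisions a ≡ 0 → Injective _≡_ _≡_ (lookup a)
collisions≡0⇒injective (v ∷ a) c≡0 {zero}  {zero}  _  = refl
collisions≡0⇒injective (v ∷ a) c≡0 {zero}  {suc j} eq =
  ⊥-elim (occurrences≡0⇒∉ v a (m+n≡0⇒m≡0 _ c≡0) j (sym eq))
collisions≡0⇒injective (v ∷ a) c≡0 {suc i} {zero}  eq =
  ⊥-elim (occurrences≡0⇒∉ v a (m+n≡0⇒m≡0 _ c≡0) i eq)
collisions≡0⇒injective (v ∷ a) c≡0 {suc i} {suc j} eq =
  cong suc (collisions≡0⇒injective a (m+n≡0⇒n≡0 (occurrences v a) c≡0) eq)

-- Counting in a graph

b2n≤1 : ∀ b → b2n b ≤ 1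
b2n≤1 true  = ≤-refl
b2n≤1 false = z≤n

b2n≡1⇒≡true : ∀ {b} → b2n b ≡ 1 → b ≡ true
b2n≡1⇒≡true {true} _ = refl

b2n-∧ : ∀ x y → b2n (x ∧ y) ≡ b2n x * b2n y
b2n-∧ true  y = sym (+-identityʳ (b2n y))
b2n-∧ false y = refl

b2n-∧-≤ʳ : ∀ x y → b2n (x ∧ y) ≤ b2n y
b2n-∧-≤ʳ true  y = ≤-refl
b2n-∧-≤ʳ false y = z≤n

module Counting {n : ℕ} (G : Graph n) where

  V : Set
  V = Fin n

  vertices : List V
  vertices = allFin n

  tuples : ∀ p → List (Vec V p)
  tuples = vecs vertices

  -- Incidences are 0/1-valued naturals, so that by ∑-^ powers of degrees and codegrees
  -- expand into sums over tuples of products of incidences.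
  A : V → V → ℕ
  A x y = b2n (adj G x y)

  joined : V → Vec V p → ℕ
  joined x = ∏ (A x)

  biclique : Vec V p → Vec V q → ℕ
  biclique a b = ∏ (λ y → joined y a) b

  codegree : V → V → ℕ
  codegree x y = ∑[ z ∈ vertices ] A x z * A y z

  codegreeWith : V → Vec V p → ℕ
  codegreeWith x a = ∑[ y ∈ vertices ] A x y * joined y a

  common : Vec V p → Vec V q → ℕ
  common a b = ∑[ x ∈ vertices ] joined x a * joined x b

  A-sym : ∀ x y → A x y ≡ A y x
  A-sym x y = cong b2n (Graph.sym G x y)

  joined≤1 : ∀ x (a : Vec V p) → joined x a ≤ 1
  joined≤1 x = ∏-≤1 (λ y → b2n≤1 (adj G x y))

  biclique≤1 : ∀ (a : Vec V p) (b : Vec V q) → biclique a b ≤ 1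
  biclique≤1 a = ∏-≤1 (λ y → joined≤1 y a)

  biclique-sym : ∀ (a : Vec V p) (b : Vec V q) → biclique a b ≡ biclique b a
  biclique-sym []      b = ∏-one b
  biclique-sym (v ∷ a) b = begin
    ∏ (λ y → A y v * joined y a) b     ≡⟨ ∏-distrib-* (λ y → A y v) (λ y → joined y a) b ⟩
    ∏ (λ y → A y v) b * biclique a b   ≡⟨ cong₂ _*_ (∏-cong (λ y → A-sym y v) b) (biclique-sym a b) ⟩
    joined v b * biclique b a          ∎
    where open ≡-Reasoning

  adj-sym : ∀ {x y} → adj G x y ≡ true → adj G y x ≡ true
  adj-sym {x} {y} = trans (Graph.sym G y x)

  adj⇒≢ : ∀ {x y} → adj G x y ≡ true → x ≢ y
  adj⇒≢ {x} xy refl with trans (sym xy) (irrefl G x)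
  ... | ()

  joined≡1⇒adj : ∀ x (a : Vec V p) → joined x a ≡ 1 → ∀ i → adj G x (lookup a i) ≡ true
  joined≡1⇒adj x a j≡1 i = b2n≡1⇒≡true (∏≡1⇒≡1 (A x) a j≡1 i)

  biclique≡1⇒adj : ∀ (a : Vec V p) (b : Vec V q) → biclique a b ≡ 1 →
                   ∀ i j → adj G (lookup a i) (lookup b j) ≡ true
  biclique≡1⇒adj a b β≡1 i j =
    adj-sym (joined≡1⇒adj (lookup b j) a (∏≡1⇒≡1 (λ y → joined y a) b β≡1 j) i)

  triangles≤∑codegree : triangles G ≤ ∑[ x ∈ vertices ] ∑[ y ∈ vertices ] A x y * codegree x y
  triangles≤∑codegree = begin
    triangles G
      ≡⟨ trans (∑-concatMap vertices _) (∑-cong vertices (λ x → ∑-concatMap vertices _)) ⟩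
    ∑[ x ∈ vertices ] ∑[ y ∈ vertices ] ∑[ z ∈ vertices ]
      b2n ((toℕ x <ᵇ toℕ y) ∧ (toℕ y <ᵇ toℕ z) ∧ adj G x y ∧ adj G y z ∧ adj G x z)
      ≤⟨ ∑-mono-≤ vertices (λ x → ∑-mono-≤ vertices (λ y → ∑-mono-≤ vertices (triangle≤ x y))) ⟩
    ∑[ x ∈ vertices ] ∑[ y ∈ vertices ] ∑[ z ∈ vertices ] A x y * (A x z * A y z)
      ≡⟨ ∑-cong vertices (λ x → ∑-cong vertices (λ y → *-distribˡ-∑ vertices (A x y) _)) ⟨
    ∑[ x ∈ vertices ] ∑[ y ∈ vertices ] A x y * codegree x y ∎
    where
    open ≤-Reasoning
    triangle≤ : ∀ x y z →
      b2n ((toℕ x <ᵇ toℕ y) ∧ (toℕ y <ᵇ toℕ z) ∧ adj G x y ∧ adj G y z ∧ adj G x z)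
        ≤ A x y * (A x z * A y z)
    triangle≤ x y z = begin
      b2n ((toℕ x <ᵇ toℕ y) ∧ (toℕ y <ᵇ toℕ z) ∧ adj G x y ∧ adj G y z ∧ adj G x z)
        ≤⟨ ≤-trans (b2n-∧-≤ʳ (toℕ x <ᵇ toℕ y) _) (b2n-∧-≤ʳ (toℕ y <ᵇ toℕ z) _) ⟩
      b2n (adj G x y ∧ adj G y z ∧ adj G x z)
        ≡⟨ trans (b2n-∧ (adj G x y) _) (cong (A x y *_) (b2n-∧ (adj G y z) _)) ⟩
      A x y * (A y z * A x z)
        ≡⟨ cong (A x y *_) (*-comm (A y z) (A x z)) ⟩
      A x y * (A x z * A y z) ∎

  codegree-^ : ∀ x y p → codegree x y ^ p ≡ ∑[ a ∈ tuples p ] joined x a * joined y a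
  codegree-^ x y p = trans (∑-^ vertices (λ z → A x z * A y z) p)
                           (∑-cong (tuples p) (∏-distrib-* (A x) (A y)))

  codegreeWith-^ : ∀ x (a : Vec V p) q →
                   codegreeWith x a ^ q ≡ ∑[ b ∈ tuples q ] joined x b * biclique a b
  codegreeWith-^ x a q = trans (∑-^ vertices (λ y → A x y * joined y a) q)
                               (∑-cong (tuples q) (∏-distrib-* (A x) (λ y → joined y a)))

  ∑codegree-^ : ∀ t →
    ∑[ x ∈ vertices ] ∑[ y ∈ vertices ] A x y * codegree x y ^ t
      ≡ ∑[ a ∈ tuples t ] ∑[ x ∈ vertices ] joined x a * codegreeWith x a
  ∑codegree-^ t = begin
    ∑[ x ∈ vertices ] ∑[ y ∈ vertices ] A x y * codegree x y ^ t
      ≡⟨ ∑-cong vertices (λ x → ∑-cong vertices (λ y →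
           trans (cong (A x y *_) (codegree-^ x y t)) (*-distribˡ-∑ (tuples t) (A x y) _))) ⟩
    ∑[ x ∈ vertices ] ∑[ y ∈ vertices ] ∑[ a ∈ tuples t ] A x y * (joined x a * joined y a)
      ≡⟨ ∑-cong vertices (λ x → ∑-comm vertices (tuples t) _) ⟩
    ∑[ x ∈ vertices ] ∑[ a ∈ tuples t ] ∑[ y ∈ vertices ] A x y * (joined x a * joined y a)
      ≡⟨ ∑-comm vertices (tuples t) _ ⟩
    ∑[ a ∈ tuples t ] ∑[ x ∈ vertices ] ∑[ y ∈ vertices ] A x y * (joined x a * joined y a)
      ≡⟨ ∑-cong (tuples t) (λ a → ∑-cong vertices (λ x →
           trans (∑-cong vertices (λ y → x∙yz≈y∙xz (A x y) (joined x a) (joined y a)))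
                 (sym (*-distribˡ-∑ vertices (joined x a) _)))) ⟩
    ∑[ a ∈ tuples t ] ∑[ x ∈ vertices ] joined x a * codegreeWith x a ∎
    where open ≡-Reasoning

  ∑codegreeWith-^ : ∀ t →
    ∑[ a ∈ tuples t ] ∑[ x ∈ vertices ] joined x a * codegreeWith x a ^ t
      ≡ ∑[ a ∈ tuples t ] ∑[ b ∈ tuples t ] biclique a b * common a b
  ∑codegreeWith-^ t = ∑-cong (tuples t) λ a → begin
    ∑[ x ∈ vertices ] joined x a * codegreeWith x a ^ t
      ≡⟨ ∑-cong vertices (λ x →
           trans (cong (joined x a *_) (codegreeWith-^ x a t)) (*-distribˡ-∑ (tuples t) (joined x a) _)) ⟩
    ∑[ x ∈ vertices ] ∑[ b ∈ tuples t ] joined x a * (joined x b * biclique a b)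
      ≡⟨ ∑-comm vertices (tuples t) _ ⟩
    ∑[ b ∈ tuples t ] ∑[ x ∈ vertices ] joined x a * (joined x b * biclique a b)
      ≡⟨ ∑-cong (tuples t) (λ b →
           trans (∑-cong vertices (λ x → x∙yz≈z∙xy (joined x a) (joined x b) (biclique a b)))
                 (sym (*-distribˡ-∑ vertices (biclique a b) _))) ⟩
    ∑[ b ∈ tuples t ] biclique a b * common a b ∎
    where open ≡-Reasoning

  Kttt-from-parts : ∀ {t} (P₀ P₁ P₂ : Fin t → V) →
    Injective _≡_ _≡_ P₀ → Injective _≡_ _≡_ P₁ → Injective _≡_ _≡_ P₂ →
    (∀ i j → adj G (P₀ i) (P₁ j) ≡ true) →
    (∀ i j → adj G (P₀ i) (P₂ j) ≡ true) →
    (∀ i j → adj G (P₁ i) (P₂ j) ≡ true) →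
    ContainsKttt G t
  Kttt-from-parts P₀ P₁ P₂ P₀-inj P₁-inj P₂-inj e₀₁ e₀₂ e₁₂ = part , part-injective , part-adj
    where
    part : Fin 3 → Fin _ → V
    part = lookup (P₀ ∷ P₁ ∷ P₂ ∷ [])

    part-adj : ∀ k l i j → k ≢ l → adj G (part k i) (part l j) ≡ true
    part-adj zero             (suc zero)       i j _ = e₀₁ i j
    part-adj zero             (suc (suc zero)) i j _ = e₀₂ i j
    part-adj (suc zero)       (suc (suc zero)) i j _ = e₁₂ i j
    part-adj (suc zero)       zero             i j _ = adj-sym (e₀₁ j i)
    part-adj (suc (suc zero)) zero             i j _ = adj-sym (e₀₂ j i)
    part-adj (suc (suc zero)) (suc zero)       i j _ = adj-sym (e₁₂ j i)
    part-adj zero             zero             i j k≢k = ⊥-elim (k≢k refl)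
    part-adj (suc zero)       (suc zero)       i j k≢k = ⊥-elim (k≢k refl)
    part-adj (suc (suc zero)) (suc (suc zero)) i j k≢k = ⊥-elim (k≢k refl)

    injective : ∀ k → Injective _≡_ _≡_ (part k)
    injective zero             = P₀-inj
    injective (suc zero)       = P₁-inj
    injective (suc (suc zero)) = P₂-inj

    part-injective : ∀ k l i j → part k i ≡ part l j → k ≡ l × i ≡ j
    part-injective k l i j eq with k ≟ l
    ... | yes refl = refl , injective k eq
    ... | no k≢l   = ⊥-elim (adj⇒≢ (part-adj k l i j k≢l) eq)

  Kttt-free⇒common≤ : ∀ {s} → ¬ ContainsKttt G (suc s) → (a b : Vec V (suc s)) →
            biclique a b ≡ 1 → collisions a ≡ 0 → collisions b ≡ 0 → common a b ≤ s
  Kttt-free⇒common≤ {s} free a b β≡1 ca≡0 cb≡0 = ≮⇒≥ λ s<common →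
    let c , c-inj , c-ones = embed-ones (λ x → joined x a * joined x b)
                               (λ x → *-mono-≤ (joined≤1 x a) (joined≤1 x b)) (suc s) s<common
    in free (Kttt-from-parts (lookup a) (lookup b) c
               (collisions≡0⇒injective a ca≡0) (collisions≡0⇒injective b cb≡0) c-inj
               (biclique≡1⇒adj a b β≡1)
               (λ i k → adj-sym (joined≡1⇒adj (c k) a (m*n≡1⇒m≡1 (joined (c k) a) _ (c-ones k)) i))
               (λ i k → adj-sym (joined≡1⇒adj (c k) b (m*n≡1⇒n≡1 (joined (c k) a) _ (c-ones k)) i)))

  biclique-∷-≤ : ∀ v (a : Vec V p) y (b : Vec V q) →
                 biclique (v ∷ a) (y ∷ b) ≤ A v y * (joined y a * joined v b)
  biclique-∷-≤ v a y b = begin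
    A y v * joined y a * biclique (v ∷ a) b
      ≡⟨ cong₂ (λ e r → e * joined y a * r) (A-sym y v) (biclique-sym (v ∷ a) b) ⟩
    A v y * joined y a * (joined v b * biclique b a)
      ≤⟨ *-monoʳ-≤ (A v y * joined y a) (m*n≤m (joined v b) (biclique≤1 b a)) ⟩
    A v y * joined y a * joined v b
      ≡⟨ *-assoc (A v y) (joined y a) (joined v b) ⟩
    A v y * (joined y a * joined v b) ∎
    where open ≤-Reasoning

  module MaxDegree (Δ : ℕ) (degree≤Δ : ∀ v → degree G v ≤ Δ) where

    ∑vertices-≤ : ∀ {f : V → ℕ} {c} → (∀ x → f x ≤ c) → ∑ vertices f ≤ n * c
    ∑vertices-≤ {c = c} f≤c = ≤-trans (∑-mono-≤ vertices f≤c) (≤-reflexive (∑-allFin-const n c))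

    ∑joined≤ : ∀ (a : Vec V (suc p)) → ∑[ x ∈ vertices ] joined x a ≤ Δ
    ∑joined≤ (y ∷ a) = begin
      ∑[ x ∈ vertices ] A x y * joined x a ≤⟨ ∑-mono-≤ vertices (λ x → m*n≤m (A x y) (joined≤1 x a)) ⟩
      ∑[ x ∈ vertices ] A x y              ≡⟨ ∑-cong vertices (λ x → A-sym x y) ⟩
      degree G y                           ≤⟨ degree≤Δ y ⟩
      Δ                                    ∎
      where open ≤-Reasoning

    common≤Δ : ∀ (a : Vec V (suc p)) (b : Vec V q) → common a b ≤ Δ
    common≤Δ a b = ≤-trans (∑-mono-≤ vertices (λ x → m*n≤m (joined x a) (joined≤1 x b))) (∑joined≤ a)

    ∑codegree-power-mean : ∀ s →
      (∑[ x ∈ vertices ] ∑[ y ∈ vertices ] A x y * codegree x y) ^ suc s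
        ≤ (n * Δ) ^ s * (∑[ x ∈ vertices ] ∑[ y ∈ vertices ] A x y * codegree x y ^ suc s)
    ∑codegree-power-mean s = ≤-trans (power-mean₂ s vertices vertices A codegree)
                                     (*-monoˡ-≤ _ (^-monoˡ-≤ s (∑vertices-≤ degree≤Δ)))

    ∑codegree-^-power-mean : ∀ s → let t = suc s in
      (∑[ x ∈ vertices ] ∑[ y ∈ vertices ] A x y * codegree x y ^ t) ^ t
        ≤ (n * Δ ^ t) ^ s * (∑[ a ∈ tuples t ] ∑[ b ∈ tuples t ] biclique a b * common a b)
    ∑codegree-^-power-mean s = begin
      (∑[ x ∈ vertices ] ∑[ y ∈ vertices ] A x y * codegree x y ^ t) ^ t
        ≡⟨ cong (_^ t) (∑codegree-^ t) ⟩
      (∑[ a ∈ tuples t ] ∑[ x ∈ vertices ] joined x a * codegreeWith x a) ^ t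
        ≤⟨ power-mean₂ s (tuples t) vertices (λ a x → joined x a) (λ a x → codegreeWith x a) ⟩
      (∑[ a ∈ tuples t ] ∑[ x ∈ vertices ] joined x a) ^ s
        * (∑[ a ∈ tuples t ] ∑[ x ∈ vertices ] joined x a * codegreeWith x a ^ t)
        ≤⟨ *-mono-≤ (^-monoˡ-≤ s ∑∑joined≤) (≤-reflexive (∑codegreeWith-^ t)) ⟩
      (n * Δ ^ t) ^ s * (∑[ a ∈ tuples t ] ∑[ b ∈ tuples t ] biclique a b * common a b) ∎
      where
      open ≤-Reasoning
      t = suc s
      ∑∑joined≤ : ∑[ a ∈ tuples t ] ∑[ x ∈ vertices ] joined x a ≤ n * Δ ^ t
      ∑∑joined≤ = begin
        ∑[ a ∈ tuples t ] ∑[ x ∈ vertices ] joined x a ≡⟨ ∑-comm (tuples t) vertices _ ⟩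
        ∑[ x ∈ vertices ] ∑[ a ∈ tuples t ] joined x a ≡⟨ ∑-cong vertices (λ x → ∑-^ vertices (A x) t) ⟨
        ∑[ x ∈ vertices ] degree G x ^ t               ≤⟨ ∑vertices-≤ (λ x → ^-monoˡ-≤ t (degree≤Δ x)) ⟩
        n * Δ ^ t                                      ∎

    -- Choose the edge v y joining the heads first; the tails then lie in N(y)ᵖ and N(v)^q.
    bicliqueCount : ∀ p q →
      ∑[ a ∈ tuples (suc p) ] ∑[ b ∈ tuples (suc q) ] biclique a b ≤ n * Δ ^ suc (p + q)
    bicliqueCount p q = begin
      ∑[ a ∈ tuples (suc p) ] ∑[ b ∈ tuples (suc q) ] biclique a b
        ≡⟨ trans (∑-vecs-suc vertices p _) (∑-cong vertices (λ v → ∑-cong (tuples p) (λ a →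
             ∑-vecs-suc vertices q (biclique (v ∷ a))))) ⟩
      ∑[ v ∈ vertices ] ∑[ a ∈ tuples p ] ∑[ y ∈ vertices ] ∑[ b ∈ tuples q ] biclique (v ∷ a) (y ∷ b)
        ≤⟨ ∑-mono-≤ vertices (λ v → ∑-mono-≤ (tuples p) (λ a → ∑-mono-≤ vertices (λ y →
             ∑-mono-≤ (tuples q) (biclique-∷-≤ v a y)))) ⟩
      ∑[ v ∈ vertices ] ∑[ a ∈ tuples p ] ∑[ y ∈ vertices ] ∑[ b ∈ tuples q ]
        A v y * (joined y a * joined v b)
        ≡⟨ ∑-cong vertices (λ v → ∑-comm (tuples p) vertices _) ⟩
      ∑[ v ∈ vertices ] ∑[ y ∈ vertices ] ∑[ a ∈ tuples p ] ∑[ b ∈ tuples q ]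
        A v y * (joined y a * joined v b)
        ≡⟨ ∑-cong vertices (λ v → ∑-cong vertices (factor v)) ⟨
      ∑[ v ∈ vertices ] ∑[ y ∈ vertices ] A v y * (degree G y ^ p * degree G v ^ q)
        ≤⟨ ∑-mono-≤ vertices (λ v → ∑-mono-≤ vertices (λ y → *-monoʳ-≤ (A v y)
             (*-mono-≤ (^-monoˡ-≤ p (degree≤Δ y)) (^-monoˡ-≤ q (degree≤Δ v))))) ⟩
      ∑[ v ∈ vertices ] ∑[ y ∈ vertices ] A v y * (Δ ^ p * Δ ^ q)
        ≡⟨ ∑-cong vertices (λ v → *-distribʳ-∑ vertices (Δ ^ p * Δ ^ q) (A v)) ⟨
      ∑[ v ∈ vertices ] degree G v * (Δ ^ p * Δ ^ q)
        ≤⟨ ∑vertices-≤ (λ v → *-monoˡ-≤ (Δ ^ p * Δ ^ q) (degree≤Δ v)) ⟩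
      n * (Δ * (Δ ^ p * Δ ^ q))
        ≡⟨ cong (λ e → n * (Δ * e)) (^-distribˡ-+-* Δ p q) ⟨
      n * Δ ^ suc (p + q) ∎
      where
      open ≤-Reasoning
      factor : ∀ v y → A v y * (degree G y ^ p * degree G v ^ q)
                     ≡ ∑[ a ∈ tuples p ] ∑[ b ∈ tuples q ] A v y * (joined y a * joined v b)
      factor v y = trans (cong (A v y *_) (trans (cong₂ _*_ (∑-^ vertices (A y) p) (∑-^ vertices (A v) q))
                                                 (∑-*-∑ (tuples p) (tuples q) (joined y) (joined v))))
                         (*-distribˡ-∑∑ (tuples p) (tuples q) (A v y) _)

    -- Peel off the head v of b: either v recurs in the tail of b, which leaves at most q + 1
    -- choices of v, or the tail has a collision and v is one of at most Δ common neighbours of a.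
    bicliqueCollisions : ∀ p q →
      ∑[ a ∈ tuples (suc p) ] ∑[ b ∈ tuples (suc q) ] biclique a b * collisions b
        ≤ q * q * (n * Δ ^ (p + q))
    bicliqueCollisions p zero = ≤-reflexive $ trans
      (∑-cong (tuples (suc p)) (λ a →
        trans (∑-cong (tuples 1) (λ { (v ∷ []) → *-zeroʳ (biclique a (v ∷ [])) })) (∑-zero (tuples 1))))
      (∑-zero (tuples (suc p)))
    bicliqueCollisions p (suc q) = begin
      ∑[ a ∈ tuples (suc p) ] ∑[ b ∈ tuples (suc (suc q)) ] biclique a b * collisions b
        ≡⟨ ∑-cong (tuples (suc p)) (λ a → trans (∑-vecs-suc vertices (suc q) _)
             (∑-cong vertices (λ v → ∑-cong (tuples (suc q)) (λ b →
               split (joined v a) (biclique a b) _ _)))) ⟩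
      ∑[ a ∈ tuples (suc p) ] ∑[ v ∈ vertices ] ∑[ b ∈ tuples (suc q) ]
        joined v a * (biclique a b * occurrences v b) + joined v a * (biclique a b * collisions b)
        ≡⟨ trans (∑-cong (tuples (suc p)) (λ a → ∑∑-distrib-+ vertices (tuples (suc q)) _ _))
                 (∑-distrib-+ (tuples (suc p)) _ _) ⟩
      (∑[ a ∈ tuples (suc p) ] ∑[ v ∈ vertices ] ∑[ b ∈ tuples (suc q) ]
         joined v a * (biclique a b * occurrences v b))
      + (∑[ a ∈ tuples (suc p) ] ∑[ v ∈ vertices ] ∑[ b ∈ tuples (suc q) ]
           joined v a * (biclique a b * collisions b))
        ≤⟨ +-mono-≤ repeated-head repeated-tail ⟩
      suc q * N + Δ * (q * q * (n * D))
        ≡⟨ cong (suc q * N +_) (regroup q Δ n D) ⟩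
      suc q * N + q * q * N
        ≤⟨ m≤m+n (suc q * N + q * q * N) (q * N) ⟩
      suc q * N + q * q * N + q * N
        ≡⟨ square q N ⟩
      suc q * suc q * N
        ≡⟨ cong (λ e → suc q * suc q * (n * Δ ^ e)) (+-suc p q) ⟨
      suc q * suc q * (n * Δ ^ (p + suc q)) ∎
      where
      open ≤-Reasoning
      D = Δ ^ (p + q)
      N = n * Δ ^ suc (p + q)
      split : ∀ j β o c → j * β * (o + c) ≡ j * (β * o) + j * (β * c)
      split = solve-∀
      regroup : ∀ q Δ n D → Δ * (q * q * (n * D)) ≡ q * q * (n * (Δ * D))
      regroup = solve-∀
      square : ∀ q N → suc q * N + q * q * N + q * N ≡ suc q * suc q * N
      square = solve-∀
      repeated-head : ∑[ a ∈ tuples (suc p) ] ∑[ v ∈ vertices ] ∑[ b ∈ tuples (suc q) ]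
                        joined v a * (biclique a b * occurrences v b) ≤ suc q * N
      repeated-head = begin
        ∑[ a ∈ tuples (suc p) ] ∑[ v ∈ vertices ] ∑[ b ∈ tuples (suc q) ]
          joined v a * (biclique a b * occurrences v b)
          ≤⟨ ∑-mono-≤ (tuples (suc p)) (λ a → ∑-mono-≤ vertices (λ v → ∑-mono-≤ (tuples (suc q)) (λ b →
               m*n≤n (biclique a b * occurrences v b) (joined≤1 v a)))) ⟩
        ∑[ a ∈ tuples (suc p) ] ∑[ v ∈ vertices ] ∑[ b ∈ tuples (suc q) ] biclique a b * occurrences v b
          ≡⟨ ∑-cong (tuples (suc p)) (λ a → ∑-comm vertices (tuples (suc q)) _) ⟩
        ∑[ a ∈ tuples (suc p) ] ∑[ b ∈ tuples (suc q) ] ∑[ v ∈ vertices ] biclique a b * occurrences v b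
          ≡⟨ ∑-cong (tuples (suc p)) (λ a → ∑-cong (tuples (suc q)) (λ b →
               trans (sym (*-distribˡ-∑ vertices (biclique a b) (λ v → occurrences v b)))
                     (trans (cong (biclique a b *_) (∑-occurrences b)) (*-comm (biclique a b) (suc q))))) ⟩
        ∑[ a ∈ tuples (suc p) ] ∑[ b ∈ tuples (suc q) ] suc q * biclique a b
          ≡⟨ *-distribˡ-∑∑ (tuples (suc p)) (tuples (suc q)) (suc q) biclique ⟨
        suc q * (∑[ a ∈ tuples (suc p) ] ∑[ b ∈ tuples (suc q) ] biclique a b)
          ≤⟨ *-monoʳ-≤ (suc q) (bicliqueCount p q) ⟩
        suc q * N ∎
      repeated-tail : ∑[ a ∈ tuples (suc p) ] ∑[ v ∈ vertices ] ∑[ b ∈ tuples (suc q) ]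
                        joined v a * (biclique a b * collisions b) ≤ Δ * (q * q * (n * D))
      repeated-tail = begin
        ∑[ a ∈ tuples (suc p) ] ∑[ v ∈ vertices ] ∑[ b ∈ tuples (suc q) ]
          joined v a * (biclique a b * collisions b)
          ≡⟨ ∑-cong (tuples (suc p)) (λ a → ∑-comm vertices (tuples (suc q)) _) ⟩
        ∑[ a ∈ tuples (suc p) ] ∑[ b ∈ tuples (suc q) ] ∑[ v ∈ vertices ]
          joined v a * (biclique a b * collisions b)
          ≡⟨ ∑-cong (tuples (suc p)) (λ a → ∑-cong (tuples (suc q)) (λ b →
               *-distribʳ-∑ vertices (biclique a b * collisions b) (λ v → joined v a))) ⟨
        ∑[ a ∈ tuples (suc p) ] ∑[ b ∈ tuples (suc q) ]
          (∑[ v ∈ vertices ] joined v a) * (biclique a b * collisions b)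
          ≤⟨ ∑-mono-≤ (tuples (suc p)) (λ a → ∑-mono-≤ (tuples (suc q)) (λ b →
               *-monoˡ-≤ (biclique a b * collisions b) (∑joined≤ a))) ⟩
        ∑[ a ∈ tuples (suc p) ] ∑[ b ∈ tuples (suc q) ] Δ * (biclique a b * collisions b)
          ≡⟨ *-distribˡ-∑∑ (tuples (suc p)) (tuples (suc q)) Δ _ ⟨
        Δ * (∑[ a ∈ tuples (suc p) ] ∑[ b ∈ tuples (suc q) ] biclique a b * collisions b)
          ≤⟨ *-monoʳ-≤ Δ (bicliqueCollisions p q) ⟩
        Δ * (q * q * (n * D)) ∎

    module _ {s} (free : ¬ ContainsKttt G (suc s)) where

      common≤s+Δ*collisions : ∀ (a b : Vec V (suc s)) → biclique a b ≡ 1 →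
                              common a b ≤ s + Δ * collisions a + Δ * collisions b
      common≤s+Δ*collisions a b β≡1 with collisions a in ca | collisions b in cb
      ... | zero  | zero  = ≤-trans (Kttt-free⇒common≤ free a b β≡1 ca cb) (≤-trans (m≤m+n s _) (m≤m+n _ _))
      ... | suc k | _     = ≤-trans (common≤Δ a b)
                              (≤-trans (m≤m*n Δ (suc k)) (≤-trans (m≤n+m _ s) (m≤m+n _ _)))
      ... | zero  | suc k = ≤-trans (common≤Δ a b) (≤-trans (m≤m*n Δ (suc k)) (m≤n+m _ _))

      biclique*common≤ : ∀ (a b : Vec V (suc s)) →
        biclique a b * common a b ≤ biclique a b * (s + Δ * collisions a + Δ * collisions b)
      biclique*common≤ a b with n≤1⇒n≡0∨n≡1 (biclique≤1 a b)
      ... | inj₁ β≡0 rewrite β≡0 = z≤n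
      ... | inj₂ β≡1 rewrite β≡1 = *-monoʳ-≤ 1 (common≤s+Δ*collisions a b β≡1)

      ∑biclique*common≤ : ∑[ a ∈ tuples (suc s) ] ∑[ b ∈ tuples (suc s) ] biclique a b * common a b
                            ≤ (s + 2 * (s * s)) * (n * Δ ^ suc (s + s))
      ∑biclique*common≤ = begin
        ∑[ a ∈ T ] ∑[ b ∈ T ] biclique a b * common a b
          ≤⟨ ∑-mono-≤ T (λ a → ∑-mono-≤ T (biclique*common≤ a)) ⟩
        ∑[ a ∈ T ] ∑[ b ∈ T ] biclique a b * (s + Δ * collisions a + Δ * collisions b)
          ≡⟨ ∑-cong T (λ a → ∑-cong T (λ b → distribute (biclique a b) s Δ (collisions a) (collisions b))) ⟩
        ∑[ a ∈ T ] ∑[ b ∈ T ] s * biclique a b + Δ * (biclique a b * collisions a)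
                                               + Δ * (biclique a b * collisions b)
          ≡⟨ trans (∑∑-distrib-+ T T _ _)
                   (cong (_+ (∑[ a ∈ T ] ∑[ b ∈ T ] Δ * (biclique a b * collisions b)))
                         (∑∑-distrib-+ T T _ _)) ⟩
        (∑[ a ∈ T ] ∑[ b ∈ T ] s * biclique a b)
          + (∑[ a ∈ T ] ∑[ b ∈ T ] Δ * (biclique a b * collisions a))
          + (∑[ a ∈ T ] ∑[ b ∈ T ] Δ * (biclique a b * collisions b))
          ≡⟨ cong₂ _+_ (cong₂ _+_ (*-distribˡ-∑∑ T T s biclique) (*-distribˡ-∑∑ T T Δ _))
                       (*-distribˡ-∑∑ T T Δ _) ⟨
        s * (∑[ a ∈ T ] ∑[ b ∈ T ] biclique a b)
          + Δ * (∑[ a ∈ T ] ∑[ b ∈ T ] biclique a b * collisions a)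
          + Δ * (∑[ a ∈ T ] ∑[ b ∈ T ] biclique a b * collisions b)
          ≤⟨ +-mono-≤ (+-mono-≤ (*-monoʳ-≤ s (bicliqueCount s s))
                                (*-monoʳ-≤ Δ (subst (_≤ _) (sym collisions-sym) (bicliqueCollisions s s))))
                      (*-monoʳ-≤ Δ (bicliqueCollisions s s)) ⟩
        s * N + Δ * (s * s * (n * D)) + Δ * (s * s * (n * D))
          ≡⟨ collect s Δ n D ⟩
        (s + 2 * (s * s)) * N ∎
        where
        open ≤-Reasoning
        T = tuples (suc s)
        D = Δ ^ (s + s)
        N = n * Δ ^ suc (s + s)
        distribute : ∀ β s Δ x y → β * (s + Δ * x + Δ * y) ≡ s * β + Δ * (β * x) + Δ * (β * y)
        distribute = solve-∀
        collect : ∀ s Δ n D → s * (n * (Δ * D)) + Δ * (s * s * (n * D)) + Δ * (s * s * (n * D))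
                            ≡ (s + 2 * (s * s)) * (n * (Δ * D))
        collect = solve-∀
        collisions-sym : ∑[ a ∈ T ] ∑[ b ∈ T ] biclique a b * collisions a
                          ≡ ∑[ a ∈ T ] ∑[ b ∈ T ] biclique a b * collisions b
        collisions-sym =
          trans (∑-cong T (λ a → ∑-cong T (λ b → cong (_* collisions a) (biclique-sym a b)))) (∑-comm T T _)

collect-powers : ∀ s n Δ K → let t = suc s in
  ((n * Δ) ^ s) ^ t * ((n * Δ ^ t) ^ s * (K * (n * Δ ^ suc (s + s))))
    ≡ K * (n ^ (t * t) * Δ ^ (2 * (t * t) ∸ 1))
collect-powers s n Δ K = begin
  ((n * Δ) ^ s) ^ t * ((n * Δ ^ t) ^ s * (K * (n * Δ ^ suc (s + s))))
    ≡⟨ cong₂ (λ l r → l * (r * (K * (n * Δ ^ suc (s + s)))))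
             (trans (^-*-assoc (n * Δ) s t) (^-distribʳ-* n Δ (s * t)))
             (trans (^-distribʳ-* n (Δ ^ t) s) (cong (n ^ s *_) (^-*-assoc Δ t s))) ⟩
  n ^ (s * t) * Δ ^ (s * t) * (n ^ s * Δ ^ (t * s) * (K * (n * Δ ^ suc (s + s))))
    ≡⟨ regroup (n ^ (s * t)) (Δ ^ (s * t)) (n ^ s) (Δ ^ (t * s)) K n (Δ ^ suc (s + s)) ⟩
  K * (n ^ (s * t) * (n * n ^ s) * (Δ ^ (s * t) * Δ ^ (t * s) * Δ ^ suc (s + s)))
    ≡⟨ cong₂ (λ l r → K * (l * r)) n-exponent Δ-exponent ⟨
  K * (n ^ (t * t) * Δ ^ (2 * (t * t) ∸ 1)) ∎
  where
  open ≡-Reasoning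
  t = suc s
  regroup : ∀ a b c d K n e → a * b * (c * d * (K * (n * e))) ≡ K * (a * (n * c) * (b * d * e))
  regroup = solve-∀
  -- 2 * (t * t) ∸ 1 unfolds to this left-hand side, which avoids the subtraction.
  exponent : ∀ s → s + s * suc s + suc (s + s * suc s + 0) ≡ s * suc s + suc s * s + suc (s + s)
  exponent = solve-∀
  n-exponent : n ^ (t * t) ≡ n ^ (s * t) * n ^ t
  n-exponent = trans (cong (n ^_) (+-comm t (s * t))) (^-distribˡ-+-* n (s * t) t)
  Δ-exponent : Δ ^ (2 * (t * t) ∸ 1) ≡ Δ ^ (s * t) * Δ ^ (t * s) * Δ ^ suc (s + s)
  Δ-exponent = trans (cong (Δ ^_) (exponent s))
                     (trans (^-distribˡ-+-* Δ (s * t + t * s) (suc (s + s)))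
                            (cong (_* Δ ^ suc (s + s)) (^-distribˡ-+-* Δ (s * t) (t * s))))

lemma3p1 : ∀ (t : ℕ) → 1 ≤ t →
    ∃[ C ] (∀ (n Δ : ℕ) (G : Graph n) →
      (∀ (v : Fin n) → degree G v ≤ Δ) →
      ¬ ContainsKttt G t →
      triangles G ^ (t * t) ≤ C * (n ^ (t * t) * Δ ^ (2 * (t * t) ∸ 1)))
lemma3p1 zero    ()
lemma3p1 (suc s) _ = K , bound
  where
  t = suc s
  K = s + 2 * (s * s)
  bound : ∀ n Δ (G : Graph n) → (∀ v → degree G v ≤ Δ) → ¬ ContainsKttt G t →
          triangles G ^ (t * t) ≤ K * (n ^ (t * t) * Δ ^ (2 * (t * t) ∸ 1))
  bound n Δ G degree≤Δ free = begin
    triangles G ^ (t * t)                            ≤⟨ ^-monoˡ-≤ (t * t) triangles≤∑codegree ⟩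
    T ^ (t * t)                                      ≡⟨ ^-*-assoc T t t ⟨
    (T ^ t) ^ t                                      ≤⟨ ^-monoˡ-≤ t (∑codegree-power-mean s) ⟩
    ((n * Δ) ^ s * M) ^ t                            ≡⟨ ^-distribʳ-* ((n * Δ) ^ s) M t ⟩
    P * M ^ t                                        ≤⟨ *-monoʳ-≤ P (∑codegree-^-power-mean s) ⟩
    P * (Q * S)                                      ≤⟨ *-monoʳ-≤ P (*-monoʳ-≤ Q (∑biclique*common≤ free)) ⟩
    P * (Q * (K * (n * Δ ^ suc (s + s))))            ≡⟨ collect-powers s n Δ K ⟩
    K * (n ^ (t * t) * Δ ^ (2 * (t * t) ∸ 1))        ∎
    where
    open Counting G
    open MaxDegree Δ degree≤Δ
    open ≤-Reasoning
    P = ((n * Δ) ^ s) ^ t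
    Q = (n * Δ ^ t) ^ s
    T = ∑[ x ∈ vertices ] ∑[ y ∈ vertices ] A x y * codegree x y
    M = ∑[ x ∈ vertices ] ∑[ y ∈ vertices ] A x y * codegree x y ^ t
    S = ∑[ a ∈ tuples t ] ∑[ b ∈ tuples t ] biclique a b * common a b
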